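{- Let $\mathcal G$ be a biconnected graph on $n-1$ vertices. Let $\mathcal Q$ be the graph on $n$ vertices obtained from $\mathcal G$ by adding a new vertex $O$ joined by a single edge to a vertex $P$ of $\mathcal G$. Then for every integer $k$ with $2\le k\le n$, the graph $\operatorname{FS}(\mathcal Q,\mathcal B_{n-k}^{(k)})$ is connected.
   Context: A graph is biconnected if it is connected, has at least $2$ vertices, and has no cut-vertex. For simple graphs $\mathcal G,\mathcal F$ on $n$ vertices, $\operatorname{FS}(\mathcal G,\mathcal F)$ has as vertices the bijections $\sigma:\mathtt V(\mathcal G)\to\mathtt V(\mathcal F)$. Two such bijections $\sigma,\sigma'$ are adjacent iff there is an edge $\{A,B\}$ of $\mathcal G$ such that $\{\sigma(A),\sigma(B)\}\in E(\mathcal F)$, $\sigma'(A)=\sigma(B)$, $\sigma'(B)=\sigma(A)$, and $\sigma'=\sigma$ elsewhere. For $1\le k\le n$, $\mathcal B_{n-k}^{(k)}$ is the graph on $n$ vertices with $k$ vertices adjacent to all other vertices and the remaining $n-k$ vertices pairwise non-adjacent. -}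

module Defs where

open import Data.Nat using (ℕ; zero; suc; _≤_)
open import Data.Nat.Properties using (_<?_)
open import Data.Fin using (Fin; zero; suc; toℕ)
open import Data.Fin.Properties using (_≟_)
open import Data.Bool using (Bool; true; false; not; _∧_; _∨_)
open import Data.Product using (_×_)
open import Data.Unit using (⊤)
open import Relation.Nullary using (¬_)
open import Relation.Nullary.Decidable using (⌊_⌋)
open import Relation.Binary.PropositionalEquality using (_≡_; _≢_)
open import Function.Definitions using (Bijective)

record SimpleGraph (n : ℕ) : Set where
  field
    adj     : Fin n → Fin n → Bool
    adj-sym : ∀ u v → adj u v ≡ adj v u
    adj-irr : ∀ v → adj v v ≡ false
open SimpleGraph public

-- Paths from u to w all of whose vertices satisfy P (given that u does).
data PathIn {n : ℕ} (A : Fin n → Fin n → Bool) (P : Fin n → Set) : Fin n → Fin n → Set where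
  here : ∀ {u w} → u ≡ w → PathIn A P u w
  step : ∀ {u x w} → A u x ≡ true → P x → PathIn A P x w → PathIn A P u w

Connected : ∀ {n} → SimpleGraph n → Set
Connected {n} G = ∀ (u w : Fin n) → PathIn (adj G) (λ _ → ⊤) u w

-- v is a cut-vertex iff G - v is disconnected; "no cut-vertex" means:
-- for every v, any two vertices u, w different from v are joined by a path avoiding v.
NoCutVertex : ∀ {n} → SimpleGraph n → Set
NoCutVertex {n} G = ∀ (v u w : Fin n) → u ≢ v → w ≢ v → PathIn (adj G) (λ x → x ≢ v) u w

Biconnected : ∀ {n} → SimpleGraph n → Set
Biconnected {n} G = Connected G × 2 ≤ n × NoCutVertex G

-- Q: G plus a new vertex O (= zero), joined by a single edge to P (= suc P in Q).
pendantAdj : ∀ {m} → SimpleGraph m → Fin m → Fin (suc m) → Fin (suc m) → Bool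
pendantAdj G P zero    zero    = false
pendantAdj G P zero    (suc j) = ⌊ j ≟ P ⌋
pendantAdj G P (suc i) zero    = ⌊ i ≟ P ⌋
pendantAdj G P (suc i) (suc j) = adj G i j

-- B^{(k)}_{n-k} on Fin n: the vertices with index < k are the k universal vertices,
-- the remaining n - k vertices are pairwise non-adjacent.
BAdj : (n k : ℕ) → Fin n → Fin n → Bool
BAdj n k u v = not ⌊ u ≟ v ⌋ ∧ (⌊ toℕ u <? k ⌋ ∨ ⌊ toℕ v <? k ⌋)

IsBij : ∀ {n} → (Fin n → Fin n) → Set
IsBij {n} σ = Bijective _≡_ _≡_ σ

-- Adjacency in FS(G,F): σ' arises from σ by swapping along an edge {A,B} of G
-- whose image {σ A, σ B} is an edge of F.
FSAdj : ∀ {n} → (Fin n → Fin n → Bool) → (Fin n → Fin n → Bool)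
      → (Fin n → Fin n) → (Fin n → Fin n) → Set
FSAdj {n} AG AF σ σ' =
  Data.Product.∃ λ (A : Fin n) → Data.Product.∃ λ (B : Fin n) →
    AG A B ≡ true × AF (σ A) (σ B) ≡ true ×
    σ' A ≡ σ B × σ' B ≡ σ A × (∀ x → x ≢ A → x ≢ B → σ' x ≡ σ x)

-- Walks in FS(G,F); vertices are bijections, identified pointwise.
data FSWalk {n : ℕ} (AG AF : Fin n → Fin n → Bool) : (Fin n → Fin n) → (Fin n → Fin n) → Set where
  done : ∀ {σ τ} → (∀ x → σ x ≡ τ x) → FSWalk AG AF σ τ
  move : ∀ {σ σ' τ} → IsBij σ' → FSAdj AG AF σ σ' → FSWalk AG AF σ' τ → FSWalk AG AF σ τ

FSConnected : ∀ {n} → (Fin n → Fin n → Bool) → (Fin n → Fin n → Bool) → Set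
FSConnected {n} AG AF = ∀ (σ τ : Fin n → Fin n) → IsBij σ → IsBij τ → FSWalk AG AF σ τ

{-# OPTIONS --safe #-}
-- The vertices of B with index < k are universal tokens, the others ordinary; two tokens can be
-- swapped along an edge of Q exactly when one of them is universal.  Relabelling a walk by a
-- transposition (a b) of two tokens of the same type gives again a walk, so to join σ to
-- (a b) ∘ σ it suffices to realise the transposition at some configuration reachable from σ.
-- Universal tokens move freely along paths of G; an ordinary token moves one step once a
-- universal token has been brought to its next vertex along a path avoiding it, which exists
-- because G has no cut-vertex.  Two universal tokens are then exchanged by placing them on O and
-- P.  For two ordinary tokens, put b on O, a on P and universal tokens on two neighbours X, Y of
-- P: rotating the star around P twice exchanges a with b and the two universal tokens with each
-- other.  A universal and an ordinary token are exchanged by first pushing the type difference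
-- along a path and then sorting with same-type transpositions.

module Submission where

open import Defs
open import Data.Bool using (Bool; true; false; not; _∧_; _∨_)
open import Data.Bool.Properties using (∨-comm)
open import Data.Empty using (⊥-elim)
open import Data.Fin using (Fin; zero; suc; toℕ; fromℕ<)
open import Data.Fin.Permutation.Components using (transpose; transpose-inverse)
open import Data.Fin.Properties using (_≟_; suc-injective; toℕ-injective; toℕ<n; toℕ-fromℕ<)
open import Data.Nat using (ℕ; zero; suc; _≤_; _<_; s≤s; z≤n)
open import Data.Nat.Properties using (_<?_; ≤-refl; ≤-trans; n≤1+n; <-irrefl; m≤n⇒m<n∨m≡n)
open import Data.Product using (∃; _×_; _,_; proj₁; proj₂)
open import Data.Sum using (_⊎_; inj₁; inj₂; [_,_])
open import Data.Unit using (⊤; tt)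
open import Function using (_∘_; Injective; Bijective)
open import Function.Consequences.Propositional
  using (inverseᵇ⇒bijective; strictlyInverseˡ⇒inverseˡ; strictlyInverseʳ⇒inverseʳ)
import Function.Construct.Composition as Composition
open import Relation.Nullary using (¬_; Dec; yes; no)
open import Relation.Nullary.Decidable using (⌊_⌋; isYes≗does; dec-true; dec-false)
open import Relation.Binary.PropositionalEquality
  using (_≡_; _≢_; _≗_; refl; sym; trans; cong; cong₂; subst; subst₂; module ≡-Reasoning)

module _ {n : ℕ} where

  transpose-matchˡ : (i j : Fin n) → transpose i j i ≡ j
  transpose-matchˡ i j rewrite dec-true (i ≟ i) refl = refl

  transpose-matchʳ : (i j : Fin n) → transpose i j j ≡ i
  transpose-matchʳ i j with j ≟ i
  ... | yes refl = refl
  ... | no _ rewrite dec-true (j ≟ j) refl = refl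

  transpose-other : {i j k : Fin n} → k ≢ i → k ≢ j → transpose i j k ≡ k
  transpose-other {i} {j} {k} k≢i k≢j
    rewrite dec-false (k ≟ i) k≢i | dec-false (k ≟ j) k≢j = refl

  ≗-by-cases : {A : Set} {f g : Fin n → A} (i j : Fin n) →
    f i ≡ g i → f j ≡ g j → (∀ k → k ≢ i → k ≢ j → f k ≡ g k) → f ≗ g
  ≗-by-cases i j fi fj other k with k ≟ i | k ≟ j
  ... | yes refl | _        = fi
  ... | no _     | yes refl = fj
  ... | no k≢i   | no k≢j   = other k k≢i k≢j

  isYes-≟-cong : {u v u′ v′ : Fin n} → (u ≡ v → u′ ≡ v′) → (u′ ≡ v′ → u ≡ v) →
    ⌊ u ≟ v ⌋ ≡ ⌊ u′ ≟ v′ ⌋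
  isYes-≟-cong {u} {v} {u′} {v′} to from with u ≟ v | u′ ≟ v′
  ... | yes _   | yes _     = refl
  ... | yes u≡v | no u′≢v′  = ⊥-elim (u′≢v′ (to u≡v))
  ... | no u≢v  | yes u′≡v′ = ⊥-elim (u≢v (from u′≡v′))
  ... | no _    | no _      = refl

  transpose-comm : (i j : Fin n) → transpose i j ≗ transpose j i
  transpose-comm i j = ≗-by-cases i j
    (trans (transpose-matchˡ i j) (sym (transpose-matchʳ j i)))
    (trans (transpose-matchʳ i j) (sym (transpose-matchˡ j i)))
    (λ _ k≢i k≢j → trans (transpose-other k≢i k≢j) (sym (transpose-other k≢j k≢i)))

  transpose-involutive : (i j k : Fin n) → transpose i j (transpose i j k) ≡ k
  transpose-involutive i j k =
    trans (cong (transpose i j) (transpose-comm i j k)) (transpose-inverse i j)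

  transpose-bijective : (i j : Fin n) → Bijective _≡_ _≡_ (transpose i j)
  transpose-bijective i j = inverseᵇ⇒bijective
    ( strictlyInverseˡ⇒inverseˡ {f⁻¹ = transpose i j} (transpose i j) (transpose-involutive i j)
    , strictlyInverseʳ⇒inverseʳ {f⁻¹ = transpose i j} (transpose i j) (transpose-involutive i j))

  transpose-preserves : {A : Set} (f : Fin n → A) {i j : Fin n} → f i ≡ f j →
    f ∘ transpose i j ≗ f
  transpose-preserves f {i} {j} fi≡fj = ≗-by-cases i j
    (trans (cong f (transpose-matchˡ i j)) (sym fi≡fj))
    (trans (cong f (transpose-matchʳ i j)) fi≡fj)
    (λ _ k≢i k≢j → cong f (transpose-other k≢i k≢j))

  transpose-conjugate : {f : Fin n → Fin n} → Injective _≡_ _≡_ f → (i j : Fin n) →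
    f ∘ transpose i j ≗ transpose (f i) (f j) ∘ f
  transpose-conjugate {f} f-inj i j = ≗-by-cases i j
    (trans (cong f (transpose-matchˡ i j)) (sym (transpose-matchˡ (f i) (f j))))
    (trans (cong f (transpose-matchʳ i j)) (sym (transpose-matchʳ (f i) (f j))))
    (λ k k≢i k≢j → trans (cong f (transpose-other k≢i k≢j))
                         (sym (transpose-other (k≢i ∘ f-inj) (k≢j ∘ f-inj))))

  transpose-chain : {A : Set} (f : Fin n → A) {p x q : Fin n} →
    p ≢ x → x ≢ q → p ≢ q → f x ≡ f q →
    f ∘ transpose p x ∘ transpose x q ≗ f ∘ transpose p q
  transpose-chain f {p} {x} {q} p≢x x≢q p≢q fx≡fq = ≗-by-cases p q
    (begin
      f (transpose p x (transpose x q p)) ≡⟨ cong (f ∘ transpose p x) (transpose-other p≢x p≢q) ⟩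
      f (transpose p x p)                 ≡⟨ cong f (transpose-matchˡ p x) ⟩
      f x                                 ≡⟨ fx≡fq ⟩
      f q                                 ≡⟨ cong f (transpose-matchˡ p q) ⟨
      f (transpose p q p)                 ∎)
    (begin
      f (transpose p x (transpose x q q)) ≡⟨ cong (f ∘ transpose p x) (transpose-matchʳ x q) ⟩
      f (transpose p x x)                 ≡⟨ cong f (transpose-matchʳ p x) ⟩
      f p                                 ≡⟨ cong f (transpose-matchʳ p q) ⟨
      f (transpose p q q)                 ∎)
    elsewhere
    where
    open ≡-Reasoning
    elsewhere : ∀ k → k ≢ p → k ≢ q → f (transpose p x (transpose x q k)) ≡ f (transpose p q k)
    elsewhere k k≢p k≢q = at-x (k ≟ x)
      where
      at-x : Dec (k ≡ x) → f (transpose p x (transpose x q k)) ≡ f (transpose p q k)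
      at-x (yes refl) = begin
        f (transpose p k (transpose k q k)) ≡⟨ cong (f ∘ transpose p k) (transpose-matchˡ k q) ⟩
        f (transpose p k q)                 ≡⟨ cong f (transpose-other (p≢q ∘ sym) (x≢q ∘ sym)) ⟩
        f q                                 ≡⟨ fx≡fq ⟨
        f k                                 ≡⟨ cong f (transpose-other k≢p k≢q) ⟨
        f (transpose p q k)                 ∎
      at-x (no k≢x) = cong f (trans (cong (transpose p x) (transpose-other k≢x k≢q))
                                   (trans (transpose-other k≢p k≢x) (sym (transpose-other k≢p k≢q))))

-- The 4-cycle o ↦ x ↦ p ↦ y ↦ o, as three swaps across p.
rotation : ∀ {n} → Fin n → Fin n → Fin n → Fin n → Fin n → Fin n
rotation o p x y = transpose p x ∘ transpose o p ∘ transpose p y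

module RotationProperties {n : ℕ} {o p x y : Fin n} (o≢p : o ≢ p) (o≢x : o ≢ x) (o≢y : o ≢ y)
         (p≢x : p ≢ x) (p≢y : p ≢ y) (x≢y : x ≢ y) where

  rotation-o : rotation o p x y o ≡ x
  rotation-o = trans (cong (transpose p x ∘ transpose o p) (transpose-other o≢p o≢y))
                     (trans (cong (transpose p x) (transpose-matchˡ o p)) (transpose-matchˡ p x))

  rotation-p : rotation o p x y p ≡ y
  rotation-p = trans (cong (transpose p x ∘ transpose o p) (transpose-matchˡ p y))
                     (trans (cong (transpose p x) (transpose-other (o≢y ∘ sym) (p≢y ∘ sym)))
                            (transpose-other (p≢y ∘ sym) (x≢y ∘ sym)))

  private
    r : Fin n → Fin n
    r = rotation o p x y

    r-x : r x ≡ p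
    r-x = trans (cong (transpose p x ∘ transpose o p) (transpose-other (p≢x ∘ sym) x≢y))
                (trans (cong (transpose p x) (transpose-other (o≢x ∘ sym) (p≢x ∘ sym)))
                       (transpose-matchʳ p x))

    r-y : r y ≡ o
    r-y = trans (cong (transpose p x ∘ transpose o p) (transpose-matchʳ p y))
                (trans (cong (transpose p x) (transpose-matchʳ o p)) (transpose-other o≢p o≢x))

  rotation-square : rotation o p x y ∘ rotation o p x y ≗ transpose x y ∘ transpose o p
  rotation-square = ≗-by-cases o p
    (trans (cong r rotation-o) (trans r-x (sym (trans (cong (transpose x y) (transpose-matchˡ o p))
                                               (transpose-other p≢x p≢y)))))
    (trans (cong r rotation-p) (trans r-y (sym (trans (cong (transpose x y) (transpose-matchʳ o p))
                                               (transpose-other o≢x o≢y)))))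
    elsewhere
    where
    elsewhere : ∀ k → k ≢ o → k ≢ p → r (r k) ≡ transpose x y (transpose o p k)
    elsewhere k k≢o k≢p = at-x-y (k ≟ x) (k ≟ y)
      where
      at-x-y : Dec (k ≡ x) → Dec (k ≡ y) → r (r k) ≡ transpose x y (transpose o p k)
      at-x-y (yes refl) _ = trans (cong r r-x) (trans rotation-p (sym (trans (cong (transpose k y)
                           (transpose-other k≢o k≢p)) (transpose-matchˡ k y))))
      at-x-y (no _) (yes refl) = trans (cong r r-y) (trans rotation-o (sym (trans (cong (transpose x k)
                           (transpose-other k≢o k≢p)) (transpose-matchʳ x k))))
      at-x-y (no k≢x) (no k≢y) = trans (cong r r-k) (trans r-k (sym (trans (cong (transpose x y)
                           (transpose-other k≢o k≢p)) (transpose-other k≢x k≢y))))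
        where
        r-k : r k ≡ k
        r-k = trans (cong (transpose p x ∘ transpose o p) (transpose-other k≢p k≢y))
                    (trans (cong (transpose p x) (transpose-other k≢o k≢p)) (transpose-other k≢p k≢x))

module _ {n : ℕ} where

  ∘-bijective : {f g : Fin n → Fin n} → IsBij f → IsBij g → IsBij (g ∘ f)
  ∘-bijective = Composition.bijective _≡_ _≡_ _≡_

  module _ {σ : Fin n → Fin n} (σ-bij : IsBij σ) where

    preimage : Fin n → Fin n
    preimage y = proj₁ (proj₂ σ-bij y)

    preimage-inverse : ∀ y → σ (preimage y) ≡ y
    preimage-inverse y = proj₂ (proj₂ σ-bij y) refl

module _ {n : ℕ} {A : Fin n → Fin n → Bool} where

  path-++ : ∀ {Pr u v w} → PathIn A Pr u v → PathIn A Pr v w → PathIn A Pr u w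
  path-++ (here refl)   q = q
  path-++ (step e p r) q = step e p (path-++ r q)

  path-to-neighbour : ∀ {Pr q t} → PathIn A Pr q t → q ≢ t → Pr q →
    ∃ λ Y → A Y t ≡ true × Pr Y × PathIn A (λ z → Pr z × z ≢ t) q Y
  path-to-neighbour (here q≡t) q≢t _ = ⊥-elim (q≢t q≡t)
  path-to-neighbour {q = q} {t} (step {x = x} e px rest) q≢t pq with x ≟ t
  ... | yes refl = q , e , pq , here refl
  ... | no x≢t with path-to-neighbour rest x≢t px
  ...   | Y , Y-t , pY , path = Y , Y-t , pY , step e (px , x≢t) path

module FSWalks {n : ℕ} (AG AF : Fin n → Fin n → Bool) where

  Config : Set
  Config = Fin n → Fin n

  Walk : Config → Config → Set
  Walk = FSWalk AG AF

  fsAdj-respˡ : ∀ {σ σ₀ σ′} → σ ≗ σ₀ → FSAdj AG AF σ₀ σ′ → FSAdj AG AF σ σ′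
  fsAdj-respˡ σ≗σ₀ (A , B , g , f , e₁ , e₂ , r) =
    A , B , g , subst₂ (λ a b → AF a b ≡ true) (sym (σ≗σ₀ A)) (sym (σ≗σ₀ B)) f ,
    trans e₁ (sym (σ≗σ₀ B)) , trans e₂ (sym (σ≗σ₀ A)) ,
    λ x x≢A x≢B → trans (r x x≢A x≢B) (sym (σ≗σ₀ x))

  walk-respˡ : ∀ {σ σ₀ τ} → σ ≗ σ₀ → Walk σ₀ τ → Walk σ τ
  walk-respˡ σ≗σ₀ (done e)       = done (λ x → trans (σ≗σ₀ x) (e x))
  walk-respˡ σ≗σ₀ (move b adj w) = move b (fsAdj-respˡ σ≗σ₀ adj) w

  walk-++ : ∀ {σ τ ρ} → Walk σ τ → Walk τ ρ → Walk σ ρ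
  walk-++ (done e)       w = walk-respˡ e w
  walk-++ (move b adj v) w = move b adj (walk-++ v w)

  walk-respʳ : ∀ {σ τ₀ τ} → Walk σ τ₀ → τ₀ ≗ τ → Walk σ τ
  walk-respʳ w e = walk-++ w (done e)

  swap-step : ∀ {σ} → IsBij σ → ∀ {A B} → AG A B ≡ true → AF (σ A) (σ B) ≡ true →
    Walk σ (σ ∘ transpose A B)
  swap-step {σ} σ-bij {A} {B} g f = move (∘-bijective (transpose-bijective A B) σ-bij)
    (A , B , g , f , cong σ (transpose-matchˡ A B) , cong σ (transpose-matchʳ A B) ,
     λ x x≢A x≢B → cong σ (transpose-other x≢A x≢B))
    (done (λ _ → refl))

  module _ (AF-sym : ∀ u v → AF u v ≡ AF v u) where

    fsAdj-sym : ∀ {σ σ′} → FSAdj AG AF σ σ′ → FSAdj AG AF σ′ σ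
    fsAdj-sym {σ} (A , B , g , f , e₁ , e₂ , r) =
      A , B , g ,
      subst₂ (λ a b → AF a b ≡ true) (sym e₁) (sym e₂) (trans (AF-sym (σ B) (σ A)) f) ,
      sym e₂ , sym e₁ , λ x x≢A x≢B → sym (r x x≢A x≢B)

    walk-sym : ∀ {σ τ} → IsBij σ → Walk σ τ → Walk τ σ
    walk-sym σ-bij (done e)        = done (sym ∘ e)
    walk-sym σ-bij (move b adj w) = walk-++ (walk-sym b w) (move σ-bij (fsAdj-sym adj) (done (λ _ → refl)))

  module _ {ρ : Config} (ρ-bij : IsBij ρ) (AF-ρ : ∀ u v → AF (ρ u) (ρ v) ≡ AF u v) where

    relabel : ∀ {σ τ} → Walk σ τ → Walk (ρ ∘ σ) (ρ ∘ τ)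
    relabel (done e) = done (cong ρ ∘ e)
    relabel {σ} (move b (A , B , g , f , e₁ , e₂ , r) w) =
      move (∘-bijective b ρ-bij)
        (A , B , g , trans (AF-ρ (σ A) (σ B)) f , cong ρ e₁ , cong ρ e₂ ,
         λ x x≢A x≢B → cong ρ (r x x≢A x≢B))
        (relabel w)

    walk-to-relabelled : (∀ u v → AF u v ≡ AF v u) → ∀ {σ τ} → IsBij σ →
      Walk σ τ → Walk τ (ρ ∘ τ) → Walk σ (ρ ∘ σ)
    walk-to-relabelled AF-sym σ-bij σ⇝τ τ⇝ρτ =
      walk-++ σ⇝τ (walk-++ τ⇝ρτ (walk-sym AF-sym (∘-bijective σ-bij ρ-bij) (relabel σ⇝τ)))

  record Reach (σ : Config) (Goal : Config → Set) : Set where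
    constructor reach
    field
      target     : Config
      walk       : Walk σ target
      target-bij : IsBij target
      goal       : Goal target

  module _ {τ : Config} (τ-bij : IsBij τ) (Good : Config → Set)
           (transposition-step : ∀ {σ} → IsBij σ → Good σ → ∀ X → σ X ≢ τ X →
              Walk σ (transpose (σ X) (τ X) ∘ σ) × Good (transpose (σ X) (τ X) ∘ σ)) where

    private
      AgreeFrom : ℕ → Config → Set
      AgreeFrom i σ = ∀ Y → i ≤ toℕ Y → σ Y ≡ τ Y

      agree-from-lower : ∀ {i} (i<n : i < n) {σ} → σ (fromℕ< i<n) ≡ τ (fromℕ< i<n) →
        AgreeFrom (suc i) σ → AgreeFrom i σ
      agree-from-lower i<n σX≡τX agree Y i≤Y with m≤n⇒m<n∨m≡n i≤Y
      ... | inj₁ i<Y = agree Y i<Y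
      ... | inj₂ i≡Y
        rewrite toℕ-injective {i = Y} {j = fromℕ< i<n} (trans (sym i≡Y) (sym (toℕ-fromℕ< i<n))) = σX≡τX

      transposition-keeps-agreement : ∀ {i} (i<n : i < n) {σ} → IsBij σ → AgreeFrom (suc i) σ →
        let X = fromℕ< i<n in AgreeFrom (suc i) (transpose (σ X) (τ X) ∘ σ)
      transposition-keeps-agreement i<n σ-bij agree Y i<Y =
        trans (cong (transpose _ _) (agree Y i<Y))
              (transpose-other (λ e → Y≢X (proj₁ σ-bij (trans (agree Y i<Y) e))) (Y≢X ∘ proj₁ τ-bij))
        where
        Y≢X : Y ≢ fromℕ< i<n
        Y≢X refl = <-irrefl (sym (toℕ-fromℕ< i<n)) i<Y

      walk-from : ∀ i → i ≤ n → ∀ {σ} → IsBij σ → Good σ → AgreeFrom i σ → Walk σ τ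
      walk-from zero    _   _     _    agree = done (λ Y → agree Y z≤n)
      walk-from (suc i) i<n {σ} σ-bij good agree with σ (fromℕ< i<n) ≟ τ (fromℕ< i<n)
      ... | yes σX≡τX = walk-from i (≤-trans (n≤1+n i) i<n) σ-bij good (agree-from-lower i<n σX≡τX agree)
      ... | no σX≢τX with transposition-step σ-bij good (fromℕ< i<n) σX≢τX
      ...   | σ⇝σ′ , good′ = walk-++ σ⇝σ′
          (walk-from i (≤-trans (n≤1+n i) i<n) (∘-bijective σ-bij (transpose-bijective _ _)) good′
            (agree-from-lower i<n (transpose-matchˡ (σ (fromℕ< i<n)) _)
              (transposition-keeps-agreement i<n σ-bij agree)))

    walk-by-transpositions : ∀ {σ} → IsBij σ → Good σ → Walk σ τ
    walk-by-transpositions σ-bij good =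
      walk-from n ≤-refl σ-bij good (λ Y n≤Y → ⊥-elim (<-irrefl refl (≤-trans (toℕ<n Y) n≤Y)))

module UniversalTokens {n : ℕ} (AG : Fin n → Fin n → Bool) (AG-irreflexive : ∀ v → AG v v ≡ false)
                       (k : ℕ) where

  open FSWalks AG (BAdj n k) public

  universal : Fin n → Bool
  universal t = ⌊ toℕ t <? k ⌋

  universal-≢ : ∀ {a b} → universal a ≡ true → universal b ≡ false → a ≢ b
  universal-≢ ua ub refl with () ← trans (sym ua) ub

  edge-≢ : ∀ {u v} → AG u v ≡ true → u ≢ v
  edge-≢ {u} e refl with () ← trans (sym e) (AG-irreflexive u)

  BAdj-sym : ∀ u v → BAdj n k u v ≡ BAdj n k v u
  BAdj-sym u v = cong₂ (λ a b → not a ∧ b) (isYes-≟-cong sym sym) (∨-comm (universal u) (universal v))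

  BAdj-relabel : ∀ {ρ : Config} → Injective _≡_ _≡_ ρ → universal ∘ ρ ≗ universal →
    ∀ u v → BAdj n k (ρ u) (ρ v) ≡ BAdj n k u v
  BAdj-relabel ρ-inj uρ u v =
    cong₂ (λ a b → not a ∧ b) (isYes-≟-cong ρ-inj (cong _)) (cong₂ _∨_ (uρ u) (uρ v))

  BAdj-universal : ∀ {u v} → u ≢ v → universal u ≡ true ⊎ universal v ≡ true → BAdj n k u v ≡ true
  BAdj-universal {u} {v} u≢v uu⊎uv with u ≟ v
  ... | yes u≡v = ⊥-elim (u≢v u≡v)
  ... | no _    = [ cong (_∨ universal v)
                  , (λ uv → trans (∨-comm (universal u) (universal v)) (cong (_∨ universal u) uv)) ] uu⊎uv

  slide : ∀ {σ} → IsBij σ → ∀ A B → AG A B ≡ true →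
    universal (σ A) ≡ true ⊎ universal (σ B) ≡ true → Walk σ (σ ∘ transpose A B)
  slide σ-bij _ _ e u = swap-step σ-bij e (BAdj-universal (edge-≢ e ∘ proj₁ σ-bij) u)

  reach-by-slide : ∀ {σ τ Goal} → Walk σ τ → IsBij τ → ∀ A B → AG A B ≡ true →
    universal (τ A) ≡ true ⊎ universal (τ B) ≡ true → Goal (τ ∘ transpose A B) → Reach σ Goal
  reach-by-slide {τ = τ} w τ-bij A B e u goal =
    reach (τ ∘ transpose A B) (walk-++ w (slide τ-bij A B e u)) (∘-bijective (transpose-bijective A B) τ-bij) goal

  either-universal-resp : ∀ {s t s′ t′} → s′ ≡ s → t′ ≡ t →
    universal s ≡ true ⊎ universal t ≡ true → universal s′ ≡ true ⊎ universal t′ ≡ true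
  either-universal-resp refl refl u = u

  walk-to-transposed : ∀ {a b} → universal a ≡ universal b → ∀ {σ τ} → IsBij σ →
    Walk σ τ → Walk τ (transpose a b ∘ τ) → Walk σ (transpose a b ∘ σ)
  walk-to-transposed {a} {b} ua≡ub = walk-to-relabelled (transpose-bijective a b)
    (BAdj-relabel (proj₁ (transpose-bijective a b)) (transpose-preserves universal ua≡ub)) BAdj-sym

  exchange-types : ∀ {p q} → PathIn AG (λ _ → ⊤) p q → ∀ {σ} → IsBij σ →
    universal (σ p) ≡ false → universal (σ q) ≡ true →
    Reach σ (λ τ → universal ∘ τ ≗ universal ∘ σ ∘ transpose p q)
  exchange-types (here refl) _ up uq with () ← trans (sym uq) up
  exchange-types {p} {q} (step {x = x} e _ rest) {σ} σ-bij up uq = by-type-of-x (universal (σ x)) refl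
    where
    open ≡-Reasoning

    p≢x : p ≢ x
    p≢x = edge-≢ e
    q≢p : q ≢ p
    q≢p = universal-≢ uq up ∘ cong σ

    by-type-of-x : ∀ c → universal (σ x) ≡ c →
      Reach σ (λ τ → universal ∘ τ ≗ universal ∘ σ ∘ transpose p q)
    by-type-of-x true ux with x ≟ q
    ... | yes refl = reach-by-slide (done (λ _ → refl)) σ-bij p x e (inj₂ ux) (λ _ → refl)
    ... | no x≢q with exchange-types rest (∘-bijective (transpose-bijective p x) σ-bij)
                        (trans (cong (universal ∘ σ) (transpose-matchʳ p x)) up)
                        (trans (cong (universal ∘ σ) (transpose-other q≢p (x≢q ∘ sym))) uq)
    ...   | reach τ w τ-bij types =
      reach τ (walk-++ (slide σ-bij p x e (inj₂ ux)) w) τ-bij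
        (λ z → trans (types z) (transpose-chain (universal ∘ σ) p≢x x≢q (q≢p ∘ sym) (trans ux (sym uq)) z))
    by-type-of-x false ux with exchange-types rest σ-bij ux uq
    ... | reach τ w τ-bij types =
      reach-by-slide w τ-bij p x e
        (inj₂ (trans (types x) (trans (cong (universal ∘ σ) (transpose-matchˡ x q)) uq)))
        types′
      where
      types′ : universal ∘ τ ∘ transpose p x ≗ universal ∘ σ ∘ transpose p q
      types′ z = begin
        universal (τ (transpose p x z))
          ≡⟨ types (transpose p x z) ⟩
        universal (σ (transpose x q (transpose p x z)))
          ≡⟨ cong (universal ∘ σ) (trans (transpose-comm x q (transpose p x z))
                                         (cong (transpose q x) (transpose-comm p x z))) ⟩
        universal (σ (transpose q x (transpose x p z)))
          ≡⟨ transpose-chain (universal ∘ σ) (universal-≢ uq ux ∘ cong σ) (p≢x ∘ sym) q≢p (trans ux (sym up)) z ⟩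
        universal (σ (transpose q p z))
          ≡⟨ cong (universal ∘ σ) (transpose-comm q p z) ⟩
        universal (σ (transpose p q z)) ∎

  module _ (swap-same-type : ∀ {σ} → IsBij σ → ∀ {a b} → universal a ≡ universal b → a ≢ b →
                               Walk σ (transpose a b ∘ σ)) where

    walk-between-same-types : ∀ {σ τ} → IsBij σ → IsBij τ → universal ∘ σ ≗ universal ∘ τ →
      Walk σ τ
    walk-between-same-types {τ = τ} σ-bij τ-bij = walk-by-transpositions τ-bij SameTypes transposition σ-bij
      where
      SameTypes : Config → Set
      SameTypes ρ = universal ∘ ρ ≗ universal ∘ τ

      transposition : ∀ {ρ} → IsBij ρ → SameTypes ρ → ∀ X → ρ X ≢ τ X →
        Walk ρ (transpose (ρ X) (τ X) ∘ ρ) × SameTypes (transpose (ρ X) (τ X) ∘ ρ)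
      transposition {ρ} ρ-bij same X ρX≢τX =
        swap-same-type ρ-bij (same X) ρX≢τX , λ z → trans (transpose-preserves universal (same X) (ρ z)) (same z)

    module _ (connected : ∀ u w → PathIn AG (λ _ → ⊤) u w) where

      swap-mixed : ∀ {σ} → IsBij σ → ∀ {a b} → universal a ≡ true → universal b ≡ false →
        Walk σ (transpose a b ∘ σ)
      swap-mixed {σ} σ-bij {a} {b} ua ub
        with exchange-types (connected (preimage σ-bij b) (preimage σ-bij a)) σ-bij
               (trans (cong universal (preimage-inverse σ-bij b)) ub)
               (trans (cong universal (preimage-inverse σ-bij a)) ua)
      ... | reach τ w τ-bij types =
        walk-++ w (walk-between-same-types τ-bij (∘-bijective σ-bij (transpose-bijective a b)) types′)
        where
        types′ : universal ∘ τ ≗ universal ∘ transpose a b ∘ σ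
        types′ z = trans (types z) (cong universal (trans (transpose-conjugate (proj₁ σ-bij) _ _ z)
          (trans (cong₂ (λ u v → transpose u v (σ z)) (preimage-inverse σ-bij b) (preimage-inverse σ-bij a))
                 (transpose-comm b a (σ z)))))

      fs-connected : FSConnected AG (BAdj n k)
      fs-connected σ τ σ-bij τ-bij = walk-by-transpositions τ-bij (λ _ → ⊤) transposition σ-bij tt
        where
        transposition : ∀ {ρ} → IsBij ρ → ⊤ → ∀ X → ρ X ≢ τ X →
          Walk ρ (transpose (ρ X) (τ X) ∘ ρ) × ⊤
        transposition {ρ} ρ-bij _ X ρX≢τX with universal (ρ X) in uρ | universal (τ X) in uτ
        ... | true  | true  = swap-same-type ρ-bij (trans uρ (sym uτ)) ρX≢τX , tt
        ... | false | false = swap-same-type ρ-bij (trans uρ (sym uτ)) ρX≢τX , tt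
        ... | true  | false = swap-mixed ρ-bij uρ uτ , tt
        ... | false | true  = walk-respʳ (swap-mixed ρ-bij uτ uρ) (transpose-comm (τ X) (ρ X) ∘ ρ) , tt

module _ {m : ℕ} (G : SimpleGraph m) (P : Fin m) where

  pendantAdj-irreflexive : ∀ v → pendantAdj G P v v ≡ false
  pendantAdj-irreflexive zero    = refl
  pendantAdj-irreflexive (suc v) = adj-irr G v

  pendantAdj-OP : pendantAdj G P zero (suc P) ≡ true
  pendantAdj-OP = trans (isYes≗does (P ≟ P)) (dec-true (P ≟ P) refl)

  pendantAdj-PO : pendantAdj G P (suc P) zero ≡ true
  pendantAdj-PO = trans (isYes≗does (P ≟ P)) (dec-true (P ≟ P) refl)

  lift-path : ∀ {Pr u w} → PathIn (adj G) Pr u w → PathIn (pendantAdj G P) (λ _ → ⊤) (suc u) (suc w)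
  lift-path (here refl)  = here refl
  lift-path (step e _ r) = step e tt (lift-path r)

  pendantAdj-connected : Connected G → ∀ u w → PathIn (pendantAdj G P) (λ _ → ⊤) u w
  pendantAdj-connected conn zero    zero    = here refl
  pendantAdj-connected conn zero    (suc w) = step pendantAdj-OP tt (lift-path (conn P w))
  pendantAdj-connected conn (suc u) zero    = path-++ (lift-path (conn u P)) (step pendantAdj-PO tt (here refl))
  pendantAdj-connected conn (suc u) (suc w) = lift-path (conn u w)

module PendantTokens {m₀ : ℕ} (G : SimpleGraph (suc (suc m₀))) (G-connected : Connected G)
                     (G-noCut : NoCutVertex G) (P : Fin (suc (suc m₀))) (k : ℕ) (2≤k : 2 ≤ k) where

  open UniversalTokens (pendantAdj G P) (pendantAdj-irreflexive G P) k public

  G-edge-≢ : ∀ {u v} → adj G u v ≡ true → u ≢ v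
  G-edge-≢ e = edge-≢ e ∘ cong suc

  <k⇒universal : ∀ t → toℕ t < k → universal t ≡ true
  <k⇒universal t t<k = trans (isYes≗does (toℕ t <? k)) (dec-true (toℕ t <? k) t<k)

  another-universal : ∀ j → ∃ λ j′ → universal j′ ≡ true × j′ ≢ j
  another-universal zero    = suc zero , <k⇒universal (suc zero) 2≤k , λ ()
  another-universal (suc _) = zero , <k⇒universal zero (≤-trans (s≤s z≤n) 2≤k) , λ ()

  position-in-G : ∀ {σ : Config} → IsBij σ → ∀ {a} → σ zero ≢ a → ∃ λ q → σ (suc q) ≡ a
  position-in-G σ-bij {a} σO≢a with preimage σ-bij a | preimage-inverse σ-bij a
  ... | zero  | σO≡a = ⊥-elim (σO≢a σO≡a)
  ... | suc q | σq≡a = q , σq≡a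

  universal-in-G : ∀ {σ : Config} → IsBij σ → ∃ λ q → universal (σ (suc q)) ≡ true
  universal-in-G {σ} σ-bij =
    let (j , uj , j≢σO) = another-universal (σ zero)
        (q , σq≡j)      = position-in-G σ-bij (j≢σO ∘ sym)
    in q , trans (cong universal σq≡j) uj

  universal-in-G-avoiding : ∀ {σ : Config} → IsBij σ → universal (σ zero) ≡ false →
    ∀ v → ∃ λ q → universal (σ (suc q)) ≡ true × q ≢ v
  universal-in-G-avoiding {σ} σ-bij uO v =
    let (j , uj , j≢σv) = another-universal (σ (suc v))
        (q , σq≡j)      = position-in-G σ-bij (λ σO≡j → universal-≢ uj uO (sym σO≡j))
    in q , trans (cong universal σq≡j) uj , λ q≡v → j≢σv (trans (sym σq≡j) (cong (σ ∘ suc) q≡v))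

  carry-universal : ∀ {Pr u w} → PathIn (adj G) Pr u w → Pr u → ∀ {σ : Config} → IsBij σ →
    universal (σ (suc u)) ≡ true →
    Reach σ (λ τ → τ (suc w) ≡ σ (suc u) × τ zero ≡ σ zero ×
                   (∀ y → ¬ Pr y → τ (suc y) ≡ σ (suc y)))
  carry-universal (here refl) _ {σ} σ-bij _ = reach σ (done (λ _ → refl)) σ-bij (refl , refl , λ _ _ → refl)
  carry-universal {Pr} {u} (step {x = x} e px rest) pu {σ} σ-bij uu
    with carry-universal rest px (∘-bijective (transpose-bijective (suc u) (suc x)) σ-bij)
           (trans (cong (universal ∘ σ) (transpose-matchʳ (suc u) (suc x))) uu)
  ... | reach τ w τ-bij (at-w , at-O , outside) =
    reach τ (walk-++ (slide σ-bij (suc u) (suc x) e (inj₁ uu)) w) τ-bij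
      ( trans at-w (cong σ (transpose-matchʳ (suc u) (suc x)))
      , trans at-O (cong σ (transpose-other {i = suc u} {j = suc x} (λ ()) (λ ())))
      , λ y ¬Pr-y → trans (outside y ¬Pr-y) (cong σ (transpose-other
          (λ y≡u → ¬Pr-y (subst Pr (sym (suc-injective y≡u)) pu))
          (λ y≡x → ¬Pr-y (subst Pr (sym (suc-injective y≡x)) px)))))

  bring-universal-to-O : ∀ {σ : Config} → IsBij σ → ∀ {j} → universal j ≡ true →
    Reach σ (λ τ → τ zero ≡ j)
  bring-universal-to-O {σ} σ-bij {j} uj with σ zero ≟ j
  ... | yes σO≡j = reach σ (done (λ _ → refl)) σ-bij σO≡j
  ... | no σO≢j with position-in-G σ-bij σO≢j
  ...   | q , σq≡j with carry-universal (G-connected q P) tt σ-bij (trans (cong universal σq≡j) uj)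
  ...     | reach τ w τ-bij (at-P , _ , _) =
    reach-by-slide w τ-bij (suc P) zero (pendantAdj-PO G P) (inj₁ (trans (cong universal (trans at-P σq≡j)) uj))
      (trans (cong τ (transpose-matchʳ (suc P) zero)) (trans at-P σq≡j))

  carry-ordinary : ∀ {p t} → PathIn (adj G) (λ _ → ⊤) p t → ∀ {σ : Config} → IsBij σ →
    universal (σ (suc p)) ≡ false → Reach σ (λ τ → τ (suc t) ≡ σ (suc p) × τ zero ≡ σ zero)
  carry-ordinary (here refl) {σ} σ-bij _ = reach σ (done (λ _ → refl)) σ-bij (refl , refl)
  carry-ordinary {p} (step {x = x} e _ rest) {σ} σ-bij up with universal-in-G σ-bij
  ... | q , uq with carry-universal (G-noCut p q x q≢p (G-edge-≢ e ∘ sym)) q≢p σ-bij uq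
    where
    q≢p : q ≢ p
    q≢p = universal-≢ uq up ∘ cong (σ ∘ suc)
  ... | reach σ₁ w₁ σ₁-bij (at-x , at-O₁ , outside₁)
    with carry-ordinary rest (∘-bijective (transpose-bijective (suc p) (suc x)) σ₁-bij)
           (trans (cong (universal ∘ σ₁) (transpose-matchʳ (suc p) (suc x)))
                  (trans (cong universal (outside₁ p (λ p≢p → p≢p refl))) up))
  ... | reach τ w τ-bij (at-t , at-O) =
    reach τ (walk-++ w₁ (walk-++ (slide σ₁-bij (suc p) (suc x) e (inj₂ (trans (cong universal at-x) uq))) w))
      τ-bij
      ( trans at-t (trans (cong σ₁ (transpose-matchʳ (suc p) (suc x))) (outside₁ p (λ p≢p → p≢p refl)))
      , trans at-O (trans (cong σ₁ (transpose-other {i = suc p} {j = suc x} (λ ()) (λ ()))) at-O₁))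

  swap-universal : ∀ {σ : Config} → IsBij σ → ∀ {a b} →
    universal a ≡ true → universal b ≡ true → a ≢ b →
    Walk σ (transpose a b ∘ σ)
  swap-universal σ-bij {a} {b} ua ub a≢b with bring-universal-to-O σ-bij ua
  ... | reach τ₁ w₁ τ₁-bij τ₁O≡a with position-in-G τ₁-bij (a≢b ∘ trans (sym τ₁O≡a))
  ...   | q , τ₁q≡b with carry-universal (G-connected q P) tt τ₁-bij (trans (cong universal τ₁q≡b) ub)
  ...     | reach τ₂ w₂ τ₂-bij (at-P , at-O , _) =
    walk-to-transposed (trans ua (sym ub)) σ-bij (walk-++ w₁ w₂)
      (walk-respʳ (slide τ₂-bij zero (suc P) (pendantAdj-OP G P)
                    (inj₁ (trans (cong universal (trans at-O τ₁O≡a)) ua)))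
        (λ z → trans (transpose-conjugate (proj₁ τ₂-bij) zero (suc P) z)
                     (cong₂ (λ u v → transpose u v (τ₂ z)) (trans at-O τ₁O≡a) (trans at-P τ₁q≡b))))

  ordinary-to-P : ∀ {σ : Config} → IsBij σ → ∀ {a} → universal a ≡ false → σ zero ≢ a →
    Reach σ (λ τ → τ (suc P) ≡ a × τ zero ≡ σ zero)
  ordinary-to-P σ-bij ua σO≢a with position-in-G σ-bij σO≢a
  ... | p , σp≡a with carry-ordinary (G-connected p P) σ-bij (trans (cong universal σp≡a) ua)
  ...   | reach τ w τ-bij (at-P , at-O) = reach τ w τ-bij (trans at-P σp≡a , at-O)

  ordinary-to-O : ∀ {σ : Config} → IsBij σ → ∀ {b} → universal b ≡ false →
    Reach σ (λ τ → τ zero ≡ b)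
  ordinary-to-O σ-bij {b} ub with another-universal b
  ... | j , uj , _ with bring-universal-to-O σ-bij uj
  ...   | reach τ₁ w₁ τ₁-bij τ₁O≡j
          with ordinary-to-P τ₁-bij ub (universal-≢ (trans (cong universal τ₁O≡j) uj) ub)
  ...     | reach τ₂ w₂ τ₂-bij (τ₂P≡b , τ₂O≡τ₁O) =
    reach-by-slide (walk-++ w₁ w₂) τ₂-bij zero (suc P) (pendantAdj-OP G P)
      (inj₁ (trans (cong universal (trans τ₂O≡τ₁O τ₁O≡j)) uj))
      (trans (cong τ₂ (transpose-matchˡ zero (suc P))) τ₂P≡b)

  record StarConfiguration (ρ : Config) (a b : Fin (suc (suc (suc m₀)))) : Set where
    field
      X Y         : Fin (suc (suc m₀))
      P-X         : adj G P X ≡ true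
      P-Y         : adj G P Y ≡ true
      X≢Y         : X ≢ Y
      at-O        : ρ zero ≡ b
      at-P        : ρ (suc P) ≡ a
      universal-X : universal (ρ (suc X)) ≡ true
      universal-Y : universal (ρ (suc Y)) ≡ true

  another-vertex : (v : Fin (suc (suc m₀))) → ∃ λ w → w ≢ v
  another-vertex zero    = suc zero , λ ()
  another-vertex (suc _) = zero , λ ()

  neighbour-of-P : ∃ λ X → adj G P X ≡ true
  neighbour-of-P with another-vertex P
  ... | v , v≢P with path-to-neighbour (G-connected v P) v≢P tt
  ...   | X , X-P , _ = X , trans (adj-sym G P X) X-P

  universal-to-neighbour : ∀ {τ : Config} → IsBij τ →
    universal (τ zero) ≡ false → universal (τ (suc P)) ≡ false → ∀ {X} → adj G P X ≡ true →
    Reach τ (λ σ → universal (σ (suc X)) ≡ true × σ zero ≡ τ zero × σ (suc P) ≡ τ (suc P))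
  universal-to-neighbour {τ} τ-bij uO uP {X} P-X with universal-in-G-avoiding τ-bij uO P
  ... | q , uq , q≢P with carry-universal (G-noCut P q X q≢P (G-edge-≢ P-X ∘ sym)) q≢P τ-bij uq
  ...   | reach σ w σ-bij (σX≡τq , σO≡τO , outside) =
    reach σ w σ-bij (trans (cong universal σX≡τq) uq , σO≡τO , outside P (λ P≢P → P≢P refl))

  second-universal-to-neighbour : ∀ {σ : Config} → IsBij σ →
    universal (σ zero) ≡ false → universal (σ (suc P)) ≡ false → ∀ {X} → adj G P X ≡ true →
    Reach σ (λ ρ → ∃ λ Y → adj G P Y ≡ true × X ≢ Y × universal (ρ (suc Y)) ≡ true ×
                   ρ zero ≡ σ zero × ρ (suc P) ≡ σ (suc P) × ρ (suc X) ≡ σ (suc X))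
  second-universal-to-neighbour {σ} σ-bij uO uP {X} P-X with universal-in-G-avoiding σ-bij uO X
  ... | q , uq , q≢X
        with path-to-neighbour (G-noCut X q P q≢X (G-edge-≢ P-X)) (universal-≢ uq uP ∘ cong (σ ∘ suc)) q≢X
  ...   | Y , Y-P , Y≢X , q⇝Y with carry-universal q⇝Y (q≢X , universal-≢ uq uP ∘ cong (σ ∘ suc)) σ-bij uq
  ...     | reach ρ w ρ-bij (ρY≡σq , ρO≡σO , outside) =
    reach ρ w ρ-bij
      ( Y , trans (adj-sym G P Y) Y-P , Y≢X ∘ sym , trans (cong universal ρY≡σq) uq
      , ρO≡σO , outside P (λ Pr-P → proj₂ Pr-P refl) , outside X (λ Pr-X → proj₁ Pr-X refl))

  reach-star : ∀ {τ : Config} → IsBij τ → ∀ {a b} → universal a ≡ false → universal b ≡ false →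
    τ zero ≡ b → τ (suc P) ≡ a → Reach τ (λ ρ → StarConfiguration ρ a b)
  reach-star {τ} τ-bij {a} {b} ua ub τO≡b τP≡a =
    let (X , P-X) = neighbour-of-P
        reach σ w σ-bij (uX , σO≡τO , σP≡τP) = universal-to-neighbour τ-bij uO uP P-X
        reach ρ w′ ρ-bij (Y , P-Y , X≢Y , uY , ρO≡σO , ρP≡σP , ρX≡σX) =
          second-universal-to-neighbour σ-bij (trans (cong universal σO≡τO) uO)
            (trans (cong universal σP≡τP) uP) P-X
    in
    reach ρ (walk-++ w w′) ρ-bij record
      { X           = X
      ; Y           = Y
      ; P-X         = P-X
      ; P-Y         = P-Y
      ; X≢Y         = X≢Y
      ; at-O        = trans ρO≡σO (trans σO≡τO τO≡b)
      ; at-P        = trans ρP≡σP (trans σP≡τP τP≡a)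
      ; universal-X = trans (cong universal ρX≡σX) uX
      ; universal-Y = uY
      }
    where
    uO : universal (τ zero) ≡ false
    uO = trans (cong universal τO≡b) ub
    uP : universal (τ (suc P)) ≡ false
    uP = trans (cong universal τP≡a) ua

  -- One hypothesis per swap P–X, O–P, P–Y, read off σ: each swap must move a universal token.
  rotate : ∀ {σ : Config} → IsBij σ → ∀ {X Y} → adj G P X ≡ true → adj G P Y ≡ true → X ≢ Y →
    universal (σ (suc P)) ≡ true ⊎ universal (σ (suc X)) ≡ true →
    universal (σ zero)    ≡ true ⊎ universal (σ (suc X)) ≡ true →
    universal (σ zero)    ≡ true ⊎ universal (σ (suc Y)) ≡ true →
    Walk σ (σ ∘ rotation zero (suc P) (suc X) (suc Y))
  rotate {σ} σ-bij {X} {Y} P-X P-Y X≢Y PX OX OY =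
    walk-++ (slide σ-bij (suc P) (suc X) P-X PX)
   (walk-++ (slide σ₁-bij zero (suc P) (pendantAdj-OP G P) (either-universal-resp σ₁O≡σO σ₁P≡σX OX))
            (slide σ₂-bij (suc P) (suc Y) P-Y (either-universal-resp σ₂P≡σO σ₂Y≡σY OY)))
    where
    σ₁ σ₂ : Config
    σ₁ = σ ∘ transpose (suc P) (suc X)
    σ₂ = σ₁ ∘ transpose zero (suc P)
    σ₁-bij : IsBij σ₁
    σ₁-bij = ∘-bijective (transpose-bijective (suc P) (suc X)) σ-bij
    σ₂-bij : IsBij σ₂
    σ₂-bij = ∘-bijective (transpose-bijective zero (suc P)) σ₁-bij
    sY≢sP : suc Y ≢ suc P
    sY≢sP = G-edge-≢ P-Y ∘ sym ∘ suc-injective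
    sY≢sX : suc Y ≢ suc X
    sY≢sX = X≢Y ∘ sym ∘ suc-injective
    σ₁O≡σO : σ₁ zero ≡ σ zero
    σ₁O≡σO = cong σ (transpose-other {i = suc P} {j = suc X} (λ ()) (λ ()))
    σ₁P≡σX : σ₁ (suc P) ≡ σ (suc X)
    σ₁P≡σX = cong σ (transpose-matchˡ (suc P) (suc X))
    σ₂P≡σO : σ₂ (suc P) ≡ σ zero
    σ₂P≡σO = trans (cong σ₁ (transpose-matchʳ zero (suc P))) σ₁O≡σO
    σ₂Y≡σY : σ₂ (suc Y) ≡ σ (suc Y)
    σ₂Y≡σY = trans (cong σ₁ (transpose-other {i = zero} (λ ()) sY≢sP))
                   (cong σ (transpose-other sY≢sP sY≢sX))

  star-swap : ∀ {ρ : Config} → IsBij ρ → ∀ {a b} → StarConfiguration ρ a b → Walk ρ (transpose a b ∘ ρ)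
  star-swap {ρ} ρ-bij {a} {b} star =
    walk-++ (rotate ρ-bij P-X P-Y X≢Y (inj₂ universal-X) (inj₂ universal-X) (inj₂ universal-Y))
   (walk-++ (rotate ρ₁-bij P-X P-Y X≢Y (inj₁ ρ₁P-universal) (inj₁ ρ₁O-universal) (inj₁ ρ₁O-universal))
            (walk-respˡ rotated-twice
              (walk-respʳ (swap-universal ξ-bij universal-X universal-Y j₁≢j₂) restored)))
    where
    open StarConfiguration star
    open ≡-Reasoning

    sP≢sX : suc P ≢ suc X
    sP≢sX = G-edge-≢ P-X ∘ suc-injective
    sP≢sY : suc P ≢ suc Y
    sP≢sY = G-edge-≢ P-Y ∘ suc-injective
    sX≢sY : suc X ≢ suc Y
    sX≢sY = X≢Y ∘ suc-injective

    open RotationProperties {o = zero} (λ ()) (λ ()) (λ ()) sP≢sX sP≢sY sX≢sY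

    r : Fin (suc (suc (suc m₀))) → Fin (suc (suc (suc m₀)))
    r = rotation zero (suc P) (suc X) (suc Y)

    ρ₁ : Config
    ρ₁ = ρ ∘ r
    ρ₁-bij : IsBij ρ₁
    ρ₁-bij = ∘-bijective (transpose-bijective (suc P) (suc Y))
               (∘-bijective (transpose-bijective zero (suc P))
                 (∘-bijective (transpose-bijective (suc P) (suc X)) ρ-bij))
    ρ₁P-universal : universal (ρ₁ (suc P)) ≡ true
    ρ₁P-universal = trans (cong (universal ∘ ρ) rotation-p) universal-Y
    ρ₁O-universal : universal (ρ₁ zero) ≡ true
    ρ₁O-universal = trans (cong (universal ∘ ρ) rotation-o) universal-X

    j₁ j₂ : Fin (suc (suc (suc m₀)))
    j₁ = ρ (suc X)
    j₂ = ρ (suc Y)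
    j₁≢j₂ : j₁ ≢ j₂
    j₁≢j₂ = sX≢sY ∘ proj₁ ρ-bij

    ξ : Config
    ξ = transpose j₁ j₂ ∘ transpose b a ∘ ρ
    ξ-bij : IsBij ξ
    ξ-bij = ∘-bijective (∘-bijective ρ-bij (transpose-bijective b a)) (transpose-bijective j₁ j₂)

    rotated-twice : ρ₁ ∘ r ≗ ξ
    rotated-twice z = begin
      ρ (r (r z))
        ≡⟨ cong ρ (rotation-square z) ⟩
      ρ (transpose (suc X) (suc Y) (transpose zero (suc P) z))
        ≡⟨ transpose-conjugate (proj₁ ρ-bij) (suc X) (suc Y) (transpose zero (suc P) z) ⟩
      transpose j₁ j₂ (ρ (transpose zero (suc P) z))
        ≡⟨ cong (transpose j₁ j₂) (transpose-conjugate (proj₁ ρ-bij) zero (suc P) z) ⟩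
      transpose j₁ j₂ (transpose (ρ zero) (ρ (suc P)) (ρ z))
        ≡⟨ cong₂ (λ u v → transpose j₁ j₂ (transpose u v (ρ z))) at-O at-P ⟩
      ξ z ∎

    restored : transpose j₁ j₂ ∘ ξ ≗ transpose a b ∘ ρ
    restored z = trans (transpose-involutive j₁ j₂ (transpose b a (ρ z))) (transpose-comm b a (ρ z))

  swap-ordinary : ∀ {σ : Config} → IsBij σ → ∀ {a b} →
    universal a ≡ false → universal b ≡ false → a ≢ b →
    Walk σ (transpose a b ∘ σ)
  swap-ordinary {σ} σ-bij {a} {b} ua ub a≢b =
    let reach τ₁ w₁ τ₁-bij τ₁O≡b = ordinary-to-O σ-bij ub
        reach τ₂ w₂ τ₂-bij (τ₂P≡a , τ₂O≡τ₁O) =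
          ordinary-to-P τ₁-bij ua (λ τ₁O≡a → a≢b (trans (sym τ₁O≡a) τ₁O≡b))
        reach ρ w₃ ρ-bij star = reach-star τ₂-bij ua ub (trans τ₂O≡τ₁O τ₁O≡b) τ₂P≡a
    in swap-at-star (walk-++ w₁ (walk-++ w₂ w₃)) ρ-bij star
    where
    swap-at-star : ∀ {ρ} → Walk σ ρ → IsBij ρ → StarConfiguration ρ a b → Walk σ (transpose a b ∘ σ)
    swap-at-star σ⇝ρ ρ-bij star = walk-to-transposed (trans ua (sym ub)) σ-bij σ⇝ρ (star-swap ρ-bij star)

  swap-same-type : ∀ {σ : Config} → IsBij σ → ∀ {a b} → universal a ≡ universal b → a ≢ b →
    Walk σ (transpose a b ∘ σ)
  swap-same-type σ-bij {a} ua≡ub a≢b with universal a in ua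
  ... | true  = swap-universal σ-bij ua (sym ua≡ub) a≢b
  ... | false = swap-ordinary σ-bij ua (sym ua≡ub) a≢b

  pendant-fs-connected : FSConnected (pendantAdj G P) (BAdj (suc (suc (suc m₀))) k)
  pendant-fs-connected = fs-connected swap-same-type (pendantAdj-connected G P G-connected)

mainTheorem6 : (m : ℕ) (G : SimpleGraph m) → Biconnected G → (P : Fin m) →
    (k : ℕ) → 2 ≤ k → k ≤ suc m →
    FSConnected (pendantAdj G P) (BAdj (suc m) k)
mainTheorem6 zero           G (_ , ()     , _) P
mainTheorem6 (suc zero)     G (_ , s≤s () , _) P
mainTheorem6 (suc (suc m₀)) G (G-connected , _ , G-noCut) P k 2≤k _ =
  PendantTokens.pendant-fs-connected G G-connected G-noCut P k 2≤k
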